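{- $\mathsf{Seq}\vdash \forall x y\,\exists z\,\forall u\,\big[\exists v_1v_2[(v_1\vdash u)\circ v_2=z]\leftrightarrow(\exists v_1v_2[(v_1\vdash u)\circ v_2=x]\vee u=y)\big]$.
   Context: $\mathsf{Seq}$ is the first-order theory in the language $\{e,\ \vdash,\ \circ\}$ ($e$ constant, $\vdash$ and $\circ$ binary function symbols; $x\vdash y$ is a term, not provability) with axioms: $\mathsf{Seq}_1$: $\forall x y\, [x\vdash y\neq e]$; $\mathsf{Seq}_2$: $\forall x_1x_2y_1y_2\,[x_1\vdash x_2=y_1\vdash y_2\rightarrow (x_1=y_1\wedge x_2=y_2)]$; $\mathsf{Seq}_3$: $\forall x\,[x\circ e=x]$; $\mathsf{Seq}_4$: $\forall xyz\,[x\circ(y\vdash z)=(x\circ y)\vdash z]$; $\mathsf{Seq}_5$: $\forall x\,[x=e\vee\exists yz\,[x=y\vdash z]]$. The displayed sentence is the translation of the adjunction axiom $\forall xy\exists z\forall u[u\in z\leftrightarrow(u\in x\vee u=y)]$ of $\mathsf{AST}$ under the translation $(x\in y)^\tau=\exists v_1v_2[(v_1\vdash x)\circ v_2=y]$. -}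

module Defs where

open import Level using (Level; suc)
open import Data.Empty using (⊥)
open import Data.Product using (Σ; ∃; _×_)
open import Data.Sum using (_⊎_)
open import Relation.Binary.PropositionalEquality using (_≡_)
open import Relation.Nullary using (¬_)

record SeqModel (ℓ : Level) : Set (suc ℓ) where
  infixl 6 _⊢_
  infixl 5 _∘_
  field
    Carrier : Set ℓ
    e       : Carrier
    _⊢_     : Carrier → Carrier → Carrier
    _∘_     : Carrier → Carrier → Carrier
    seq₁ : ∀ x y → ¬ (x ⊢ y ≡ e)
    seq₂ : ∀ x₁ x₂ y₁ y₂ → x₁ ⊢ x₂ ≡ y₁ ⊢ y₂ → (x₁ ≡ y₁) × (x₂ ≡ y₂)
    seq₃ : ∀ x → x ∘ e ≡ x
    seq₄ : ∀ x y z → x ∘ (y ⊢ z) ≡ (x ∘ y) ⊢ z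
    seq₅ : ∀ x → (x ≡ e) ⊎ Σ Carrier (λ y → Σ Carrier (λ z → x ≡ y ⊢ z))

  -- translation of membership: (x ∈ y)^τ = ∃ v₁ v₂ [(v₁ ⊢ x) ∘ v₂ = y]
  _∈τ_ : Carrier → Carrier → Set ℓ
  x ∈τ y = Σ Carrier (λ v₁ → Σ Carrier (λ v₂ → (v₁ ⊢ x) ∘ v₂ ≡ y))

{-# OPTIONS --safe #-}
module Submission where

-- The witness is z = x ⊢ y. By Seq5 the tail v₂ of a membership witness
-- (v₁ ⊢ u) ∘ v₂ = x ⊢ y is either e, and then Seq3 and Seq2 force u = y, or
-- a ⊢ b, and then Seq4 and Seq2 give (v₁ ⊢ u) ∘ a = x, i.e. u ∈τ x.
-- Conversely, Seq3 puts y into x ⊢ y and Seq4 extends any witness for x.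

open import Defs
open import Level using (Level)
open import Data.Product using (Σ; _×_; _,_; proj₁; proj₂)
open import Data.Sum using (_⊎_; inj₁; inj₂; [_,_])
open import Relation.Binary.PropositionalEquality using (_≡_; refl; sym; trans; cong)

module SeqProperties {ℓ : Level} (M : SeqModel ℓ) where
  open SeqModel M

  ⊢-injectiveˡ : ∀ {x₁ x₂ y₁ y₂} → x₁ ⊢ x₂ ≡ y₁ ⊢ y₂ → x₁ ≡ y₁
  ⊢-injectiveˡ eq = proj₁ (seq₂ _ _ _ _ eq)

  ⊢-injectiveʳ : ∀ {x₁ x₂ y₁ y₂} → x₁ ⊢ x₂ ≡ y₁ ⊢ y₂ → x₂ ≡ y₂
  ⊢-injectiveʳ eq = proj₂ (seq₂ _ _ _ _ eq)

  ∈τ-⊢-here : ∀ x y → y ∈τ (x ⊢ y)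
  ∈τ-⊢-here x y = x , e , seq₃ (x ⊢ y)

  ∈τ-⊢-there : ∀ {u x} y → u ∈τ x → u ∈τ (x ⊢ y)
  ∈τ-⊢-there {u} y (v₁ , v₂ , eq) =
    v₁ , v₂ ⊢ y , trans (seq₄ (v₁ ⊢ u) v₂ y) (cong (_⊢ y) eq)

  ∈τ-⊢⁻ : ∀ {u x y} → u ∈τ (x ⊢ y) → (u ∈τ x) ⊎ (u ≡ y)
  ∈τ-⊢⁻ {u} (v₁ , v₂ , eq) with seq₅ v₂
  ... | inj₁ refl = inj₂ (⊢-injectiveʳ (trans (sym (seq₃ (v₁ ⊢ u))) eq))
  ... | inj₂ (a , b , refl) = inj₁ (v₁ , a , ⊢-injectiveˡ (trans (sym (seq₄ (v₁ ⊢ u) a b)) eq))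

  ∈τ-⊢⁺ : ∀ {u x y} → (u ∈τ x) ⊎ (u ≡ y) → u ∈τ (x ⊢ y)
  ∈τ-⊢⁺ {x = x} {y} = [ ∈τ-⊢-there y , (λ { refl → ∈τ-⊢-here x y }) ]

lemma4 : ∀ {ℓ : Level} (M : SeqModel ℓ) → let open SeqModel M in
    ∀ x y → Σ Carrier (λ z → ∀ u →
    ((u ∈τ z) → ((u ∈τ x) ⊎ (u ≡ y))) × (((u ∈τ x) ⊎ (u ≡ y)) → (u ∈τ z)))
lemma4 M x y = x ⊢ y , λ _ → ∈τ-⊢⁻ , ∈τ-⊢⁺
  where
  open SeqModel M
  open SeqProperties M
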